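{- There exist a constant $c>0$ and, for infinitely many $n$, a simple undirected unweighted graph $G$ on $n$ nodes together with an initial coloring of its nodes with two colors, such that in the sequential adversarial model the minority process on $G$ admits a sequence of at least $c\,n^2$ valid steps (i.e., the stabilization time in the sequential adversarial model is $\Omega(n^2)$).
   Context: Let $G$ be a simple, unweighted, undirected graph whose nodes are colored with two colors (black and white). A node $v$ is switchable in the current coloring if, with $v$ currently colored $c_1$, the other color $c_2$ occurs strictly fewer times than $c_1$ among the neighbors of $v$; switching $v$ means changing its color to the color least frequent in its neighborhood (with two colors: to the other color). The minority process is a sequence of steps, each step consisting of a set of nodes that switch simultaneously; a step is valid only if every chosen node is switchable in the coloring before the step. A coloring is stable if no node is switchable, and the stabilization time is the number of steps until a stable coloring is reached. In the sequential adversarial model, each step switches exactly one switchable node, and the order is chosen by an adversary who maximizes the number of steps; thus the stabilization time is the maximum length of a sequence of valid single-node steps. -}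

module Defs where

open import Data.Nat using (ℕ; zero; suc; _+_; _<_)
open import Data.Bool using (Bool; true; false; not; _∧_; if_then_else_)
open import Data.Fin using (Fin; _≟_)
open import Data.List using (List; []; _∷_; map; allFin)
open import Data.Nat.ListAction using (sum)
open import Data.Product using (_×_)
open import Data.Unit using (⊤)
open import Relation.Nullary.Decidable using (⌊_⌋)
open import Relation.Binary.PropositionalEquality using (_≡_)

-- Colors: Bool (true = black, false = white).
Color : Set
Color = Bool

record Graph (n : ℕ) : Set where
  field
    adj    : Fin n → Fin n → Bool
    sym    : ∀ i j → adj i j ≡ adj j i
    irrefl : ∀ i → adj i i ≡ false
open Graph public

Coloring : ℕ → Set
Coloring n = Fin n → Color

sameColor : Color → Color → Bool
sameColor true  true  = true
sameColor false false = true
sameColor _     _     = false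

nbrCount : ∀ {n} → Graph n → Coloring n → Fin n → Color → ℕ
nbrCount {n} G col v c =
  sum (map (λ j → if adj G v j ∧ sameColor (col j) c then 1 else 0) (allFin n))

Switchable : ∀ {n} → Graph n → Coloring n → Fin n → Set
Switchable G col v = nbrCount G col v (not (col v)) < nbrCount G col v (col v)

switch : ∀ {n} → Coloring n → Fin n → Coloring n
switch col v u = if ⌊ u ≟ v ⌋ then not (col u) else col u

ValidSeq : ∀ {n} → Graph n → Coloring n → List (Fin n) → Set
ValidSeq G col []       = ⊤
ValidSeq G col (v ∷ vs) = Switchable G col v × ValidSeq G (switch col v) vs

-- Take a clique on the nodes 0 … k−1 and give clique node x exactly x black and k − x white
-- neighbours outside the clique, which themselves never switch. If B clique nodes are black, a
-- white clique node x sees B + x black and 2k − 1 − B − x white neighbours, and a black one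
-- B + x − 1 black and 2k − B − x white ones: white x may switch iff x + B < k, black x iff
-- x + B > k. From the black prefix [0, a) of the clique, with r = k − a, the adversary turns
-- r − 1, …, a black one by one (each time x + B = k − 1), then a + 1, …, r − 1 white again
-- (each time x + B = k + 1), arriving at the prefix [0, a + 1) after 2(r − a) − 1 steps.
-- Starting from a = 0 with k = 2m this gives 2m² + m steps on 6m nodes.

module Submission where

open import Defs using (Color; Graph; Coloring; sameColor; nbrCount; Switchable; switch; ValidSeq)
open import Data.Bool using (Bool; true; false; not; _∧_; _∨_; if_then_else_)
open import Data.Bool.Properties using (T-≡; ¬-not; ∧-identityʳ; ∧-zeroʳ; ∨-zeroʳ; ∨-identityʳ)
open import Data.Fin as Fin using (Fin; toℕ; fromℕ<)
open import Data.Fin.Properties using (toℕ-fromℕ<; toℕ-injective)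
open import Data.List using (List; []; _∷_; _++_; length; map; allFin; tabulate; applyDownFrom)
open import Data.List.Properties using (length-++; map-tabulate; length-applyDownFrom)
open import Data.Nat
open import Data.Nat.ListAction using (sum)
open import Data.Nat.Properties
open import Data.Nat.Tactic.RingSolver using (solve-∀)
open import Data.Product using (Σ; _×_; _,_)
open import Data.Unit using (⊤; tt)
open import Function using (_∘_; id)
open import Function.Bundles using (Equivalence)
open import Relation.Nullary using (yes; no)
open import Relation.Nullary.Decidable using (⌊_⌋)
open import Relation.Binary.PropositionalEquality

<ᵇ-true : ∀ {m n} → m < n → (m <ᵇ n) ≡ true
<ᵇ-true m<n = Equivalence.to T-≡ (<⇒<ᵇ m<n)

<ᵇ-false : ∀ {m n} → n ≤ m → (m <ᵇ n) ≡ false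
<ᵇ-false {m} {n} n≤m = ¬-not (λ eq → ≤⇒≯ n≤m (<ᵇ⇒< m n (Equivalence.from T-≡ eq)))

≡ᵇ-refl : ∀ m → (m ≡ᵇ m) ≡ true
≡ᵇ-refl m = Equivalence.to T-≡ (≡⇒≡ᵇ m m refl)

≡ᵇ-false : ∀ {m n} → m ≢ n → (m ≡ᵇ n) ≡ false
≡ᵇ-false {m} {n} m≢n = ¬-not (λ eq → m≢n (≡ᵇ⇒≡ m n (Equivalence.from T-≡ eq)))

≡ᵇ-sym : ∀ m n → (m ≡ᵇ n) ≡ (n ≡ᵇ m)
≡ᵇ-sym zero    zero    = refl
≡ᵇ-sym zero    (suc n) = refl
≡ᵇ-sym (suc m) zero    = refl
≡ᵇ-sym (suc m) (suc n) = ≡ᵇ-sym m n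

<ᵇ-suc : ∀ {y j} → y ≢ j → (y <ᵇ suc j) ≡ (y <ᵇ j)
<ᵇ-suc {y} {j} y≢j with y <? j
... | yes y<j rewrite <ᵇ-true y<j = <ᵇ-true (m≤n⇒m≤1+n y<j)
... | no  y≮j rewrite <ᵇ-false (≮⇒≥ y≮j) = <ᵇ-false (≤∧≢⇒< (≮⇒≥ y≮j) (y≢j ∘ sym))

χ : Bool → ℕ
χ b = if b then 1 else 0

count : ℕ → (ℕ → Bool) → ℕ
count zero    P = 0
count (suc n) P = χ (P 0) + count n (P ∘ suc)

count-cong : ∀ n {P Q : ℕ → Bool} → (∀ y → y < n → P y ≡ Q y) → count n P ≡ count n Q
count-cong zero    eq = refl
count-cong (suc n) eq = cong₂ _+_ (cong χ (eq 0 z<s)) (count-cong n (λ y y<n → eq (suc y) (s<s y<n)))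

count-+ : ∀ m n P → count (m + n) P ≡ count m P + count n (λ y → P (m + y))
count-+ zero    n P = refl
count-+ (suc m) n P = trans (cong (χ (P 0) +_) (count-+ m n (P ∘ suc))) (sym (+-assoc (χ (P 0)) _ _))

count-false : ∀ n {P} → (∀ y → y < n → P y ≡ false) → count n P ≡ 0
count-false zero    eq = refl
count-false (suc n) eq rewrite eq 0 z<s = count-false n (λ y y<n → eq (suc y) (s<s y<n))

count-true : ∀ n {P} → (∀ y → y < n → P y ≡ true) → count n P ≡ n
count-true zero    eq = refl
count-true (suc n) eq rewrite eq 0 z<s = cong suc (count-true n (λ y y<n → eq (suc y) (s<s y<n)))

count-not : ∀ n P → count n P + count n (not ∘ P) ≡ n
count-not zero    P = refl
count-not (suc n) P with P 0 | count-not n (P ∘ suc)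
... | true  | eq = cong suc eq
... | false | eq = trans (+-suc _ _) (cong suc eq)

count-< : ∀ {x n} → x ≤ n → count n (_<ᵇ x) ≡ x
count-< {x} x≤n with m≤n⇒∃[o]m+o≡n x≤n
... | o , refl = begin
  count (x + o) (_<ᵇ x)                                 ≡⟨ count-+ x o _ ⟩
  count x (_<ᵇ x) + count o (λ y → x + y <ᵇ x)          ≡⟨ cong₂ _+_ below-x above-x ⟩
  x + 0                                                 ≡⟨ +-identityʳ x ⟩
  x                                                     ∎
  where
  open ≡-Reasoning
  below-x : count x (_<ᵇ x) ≡ x
  below-x = count-true x (λ y → <ᵇ-true)
  above-x : count o (λ y → x + y <ᵇ x) ≡ 0
  above-x = count-false o (λ y _ → <ᵇ-false (m≤m+n x y))

count-drop : ∀ {x} n P → x < n → count n (λ y → not (x ≡ᵇ y) ∧ P y) + χ (P x) ≡ count n P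
count-drop {zero}  (suc n) P _         = +-comm (count n (P ∘ suc)) (χ (P 0))
count-drop {suc x} (suc n) P (s<s x<n) =
  trans (+-assoc (χ (P 0)) _ _) (cong (χ (P 0) +_) (count-drop n (P ∘ suc) x<n))

sum-allFin : ∀ n {f : Fin n → Bool} {P : ℕ → Bool} → (∀ j → f j ≡ P (toℕ j)) →
             sum (map (χ ∘ f) (allFin n)) ≡ count n P
sum-allFin n {f} f≗P = trans (cong sum (map-tabulate id (χ ∘ f))) (go n f≗P)
  where
  go : ∀ n {f : Fin n → Bool} {P : ℕ → Bool} → (∀ j → f j ≡ P (toℕ j)) → sum (tabulate (χ ∘ f)) ≡ count n P
  go zero    f≗P = refl
  go (suc n) f≗P = cong₂ _+_ (cong χ (f≗P Fin.zero)) (go n (f≗P ∘ Fin.suc))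

≟-toℕ : ∀ {n} (i v : Fin n) → ⌊ i Fin.≟ v ⌋ ≡ (toℕ i ≡ᵇ toℕ v)
≟-toℕ i v with i Fin.≟ v
... | yes refl = sym (≡ᵇ-refl (toℕ i))
... | no  i≢v  = sym (≡ᵇ-false (i≢v ∘ toℕ-injective))

sameColor-true : ∀ b → sameColor b true ≡ b
sameColor-true true  = refl
sameColor-true false = refl

sameColor-false : ∀ b → sameColor b false ≡ not b
sameColor-false true  = refl
sameColor-false false = refl

switchℕ : (ℕ → Color) → ℕ → ℕ → Color
switchℕ C v y = if y ≡ᵇ v then not (C y) else C y

-- Graphs on Fin N presented by a Boolean relation on ℕ, so that the construction can use
-- plain arithmetic on node names; toValidSeq transports sequences back to Fin N.
module PrefixGraph (N : ℕ) (A : ℕ → ℕ → Bool) where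

  nbrCountℕ : (ℕ → Color) → ℕ → Color → ℕ
  nbrCountℕ C x c = count N (λ y → A x y ∧ sameColor (C y) c)

  Switchableℕ : (ℕ → Color) → ℕ → Set
  Switchableℕ C x = nbrCountℕ C x (not (C x)) < nbrCountℕ C x (C x)

  ValidSeqℕ : (ℕ → Color) → List ℕ → Set
  ValidSeqℕ C []       = ⊤
  ValidSeqℕ C (x ∷ xs) = x < N × Switchableℕ C x × ValidSeqℕ (switchℕ C x) xs

  switchable-at : ∀ {C x} b → C x ≡ b → nbrCountℕ C x (not b) < nbrCountℕ C x b → Switchableℕ C x
  switchable-at _ refl lt = lt

  ValidSeqℕ-cong : ∀ xs {C C′ : ℕ → Color} → C ≗ C′ → ValidSeqℕ C xs → ValidSeqℕ C′ xs
  ValidSeqℕ-cong []       C≗C′ _                = tt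
  ValidSeqℕ-cong (x ∷ xs) {C} {C′} C≗C′ (x<N , sw , rest) =
    x<N ,
    switchable-at (C x) (sym (C≗C′ x)) (subst₂ _<_ (same-nbrs _) (same-nbrs _) sw) ,
    ValidSeqℕ-cong xs (λ y → cong (λ b → if y ≡ᵇ x then not b else b) (C≗C′ y)) rest
    where
    same-nbrs : ∀ c → nbrCountℕ C x c ≡ nbrCountℕ C′ x c
    same-nbrs c = count-cong N (λ y _ → cong (λ b → A x y ∧ sameColor b c) (C≗C′ y))

  module _ (A-sym : ∀ x y → A x y ≡ A y x) (A-irrefl : ∀ x → A x x ≡ false) where

    graph : Graph N
    graph = record
      { adj    = λ i j → A (toℕ i) (toℕ j)
      ; sym    = λ i j → A-sym (toℕ i) (toℕ j)
      ; irrefl = λ i → A-irrefl (toℕ i)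
      }

    nbrCount-graph : ∀ {col C} → col ≗ C ∘ toℕ → ∀ v c → nbrCount graph col v c ≡ nbrCountℕ C (toℕ v) c
    nbrCount-graph col≗C v c = sum-allFin N (λ j → cong (λ b → A (toℕ v) (toℕ j) ∧ sameColor b c) (col≗C j))

    toValidSeq : ∀ xs {C col} → col ≗ C ∘ toℕ → ValidSeqℕ C xs →
                 Σ (List (Fin N)) λ σ → ValidSeq graph col σ × length σ ≡ length xs
    toValidSeq []       col≗C _                   = [] , tt , refl
    toValidSeq (x ∷ xs) {C} {col} col≗C (x<N , sw , rest) =
      let σ , valid , len = toValidSeq xs switched rest
      in  v ∷ σ , (switchable , valid) , cong suc len
      where
      v : Fin N
      v = fromℕ< x<N
      switched : switch col v ≗ switchℕ C x ∘ toℕ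
      switched i rewrite ≟-toℕ i v | toℕ-fromℕ< x<N =
        cong (λ b → if toℕ i ≡ᵇ x then not b else b) (col≗C i)
      nbrs : ∀ c → nbrCount graph col v c ≡ nbrCountℕ C x c
      nbrs c = trans (nbrCount-graph col≗C v c) (cong (λ y → nbrCountℕ C y c) (toℕ-fromℕ< x<N))
      switchable : Switchable graph col v
      switchable = subst (λ b → nbrCount graph col v (not b) < nbrCount graph col v b)
                     (sym (trans (col≗C v) (cong C (toℕ-fromℕ< x<N))))
                     (subst₂ _<_ (sym (nbrs _)) (sym (nbrs _)) sw)

band : ℕ → ℕ → ℕ → ℕ → Bool
band p q r y = (y <ᵇ p) ∨ (not (y <ᵇ q) ∧ (y <ᵇ r))

band-prefix : ∀ {p q r} → r ≤ q → band p q r ≗ (_<ᵇ p)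
band-prefix {q = q} r≤q y with y <? q
... | yes y<q rewrite <ᵇ-true y<q = ∨-identityʳ _
... | no  y≮q rewrite <ᵇ-false (≮⇒≥ y≮q) | <ᵇ-false (≤-trans r≤q (≮⇒≥ y≮q)) = ∨-identityʳ _

band-filled : ∀ {p q r} → q ≤ p → p ≤ r → band p q r ≗ (_<ᵇ r)
band-filled {p} q≤p p≤r y with y <? p
... | yes y<p rewrite <ᵇ-true y<p | <ᵇ-true (<-≤-trans y<p p≤r) = refl
... | no  y≮p rewrite <ᵇ-false (≮⇒≥ y≮p) | <ᵇ-false (≤-trans q≤p (≮⇒≥ y≮p)) = refl

band-below : ∀ {p j r} → p ≤ j → band p (suc j) r j ≡ false
band-below {j = j} p≤j rewrite <ᵇ-false p≤j | <ᵇ-true (n<1+n j) = refl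

band-at : ∀ {p q r} → p ≤ q → q < r → band p q r q ≡ true
band-at {q = q} p≤q q<r rewrite <ᵇ-false p≤q | <ᵇ-false (≤-refl {q}) | <ᵇ-true q<r = refl

count-band : ∀ {p q r n} → p ≤ q → q ≤ r → r ≤ n → count n (band p q r) + q ≡ p + r
count-band {p} {q} p≤q q≤r r≤n with m≤n⇒∃[o]m+o≡n q≤r
... | d , refl with m≤n⇒∃[o]m+o≡n r≤n
... | e , refl = begin
  count (q + d + e) B + q
    ≡⟨ cong (_+ q) (count-+ (q + d) e B) ⟩
  count (q + d) B + count e (λ y → B (q + d + y)) + q
    ≡⟨ cong (λ n → n + count e (λ y → B (q + d + y)) + q) (count-+ q d B) ⟩
  count q B + count d (λ y → B (q + y)) + count e (λ y → B (q + d + y)) + q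
    ≡⟨ cong (_+ q) (cong₂ _+_ (cong₂ _+_ before-q inside) after-r) ⟩
  p + d + 0 + q
    ≡⟨ rearrange p q d ⟩
  p + (q + d)
    ∎
  where
  open ≡-Reasoning
  B : ℕ → Bool
  B = band p q (q + d)
  before-q : count q B ≡ p
  before-q = trans (count-cong q below) (count-< p≤q)
    where
    below : ∀ y → y < q → B y ≡ (y <ᵇ p)
    below y y<q rewrite <ᵇ-true y<q = ∨-identityʳ (y <ᵇ p)
  inside : count d (λ y → B (q + y)) ≡ d
  inside = count-true d within
    where
    within : ∀ y → y < d → B (q + y) ≡ true
    within y y<d rewrite <ᵇ-false (m≤m+n q y) | <ᵇ-true (+-monoʳ-< q y<d) = ∨-zeroʳ _
  after-r : count e (λ y → B (q + d + y)) ≡ 0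
  after-r = count-false e (λ y _ → beyond y)
    where
    beyond : ∀ y → B (q + d + y) ≡ false
    beyond y rewrite <ᵇ-false (≤-trans p≤q (≤-trans (m≤m+n q d) (m≤m+n (q + d) y)))
                   | <ᵇ-false (m≤m+n (q + d) y) = ∧-zeroʳ _
  rearrange : ∀ p q d → p + d + 0 + q ≡ p + (q + d)
  rearrange = solve-∀

switch-band-grow : ∀ {p j r} → p ≤ j → j < r → switchℕ (band p (suc j) r) j ≗ band p j r
switch-band-grow {p} {j} {r} p≤j j<r y with y ≟ j
... | yes refl rewrite ≡ᵇ-refl y | <ᵇ-false p≤j | <ᵇ-true (n<1+n y) | <ᵇ-false (≤-refl {y}) | <ᵇ-true j<r = refl
... | no  y≢j  rewrite ≡ᵇ-false y≢j = cong (λ b → (y <ᵇ p) ∨ (not b ∧ (y <ᵇ r))) (<ᵇ-suc y≢j)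

switch-band-shrink : ∀ {p q r} → p ≤ q → q < r → switchℕ (band p q r) q ≗ band p (suc q) r
switch-band-shrink {p} {q} {r} p≤q q<r y with y ≟ q
... | yes refl rewrite ≡ᵇ-refl y | <ᵇ-false p≤q | <ᵇ-true (n<1+n y) | <ᵇ-false (≤-refl {y}) | <ᵇ-true q<r = refl
... | no  y≢q  rewrite ≡ᵇ-false y≢q = cong (λ b → (y <ᵇ p) ∨ (not b ∧ (y <ᵇ r))) (sym (<ᵇ-suc y≢q))

ascending : ℕ → ℕ → List ℕ
ascending q zero    = []
ascending q (suc d) = q ∷ ascending (suc q) d

schedule : ℕ → ℕ → List ℕ
schedule a zero    = []
schedule a (suc i) = applyDownFrom (a +_) (suc i + suc i) ++ (ascending (suc a) (i + suc i) ++ schedule (suc a) i)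

length-ascending : ∀ q d → length (ascending q d) ≡ d
length-ascending q zero    = refl
length-ascending q (suc d) = cong suc (length-ascending (suc q) d)

length-schedule : ∀ i a → length (schedule a i) ≡ i * (i + i) + i
length-schedule zero    a = refl
length-schedule (suc i) a = begin
  length (schedule a (suc i))
    ≡⟨ length-++ (applyDownFrom (a +_) (suc i + suc i)) ⟩
  length (applyDownFrom (a +_) (suc i + suc i)) + length (ascending (suc a) (i + suc i) ++ schedule (suc a) i)
    ≡⟨ cong₂ _+_ (length-applyDownFrom (a +_) (suc i + suc i))
                 (trans (length-++ (ascending (suc a) (i + suc i)))
                        (cong₂ _+_ (length-ascending (suc a) (i + suc i)) (length-schedule i (suc a)))) ⟩
  (suc i + suc i) + ((i + suc i) + (i * (i + i) + i))
    ≡⟨ rearrange i ⟩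
  suc i * (suc i + suc i) + suc i
    ∎
  where
  open ≡-Reasoning
  rearrange : ∀ i → (suc i + suc i) + ((i + suc i) + (i * (i + i) + i)) ≡ suc i * (suc i + suc i) + suc i
  rearrange = solve-∀

below-half : ∀ {a s k} → a + 1 + s ≡ k + k → s < k → s < a
below-half {a} {s} {k} eq s<k = +-cancelʳ-≤ (suc s) (suc s) a (begin
  suc s + suc s  ≤⟨ +-mono-≤ s<k s<k ⟩
  k + k          ≡⟨ sym eq ⟩
  a + 1 + s      ≡⟨ +-assoc a 1 s ⟩
  a + suc s      ∎)
  where open ≤-Reasoning

above-half : ∀ {a s k} → a + s ≡ k + k → k < s → a < k
above-half {a} {s} {k} eq k<s = +-cancelʳ-< s a k (begin-strict
  a + s  ≡⟨ eq ⟩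
  k + k  <⟨ +-monoʳ-< k k<s ⟩
  k + s  ∎)
  where open ≤-Reasoning

module Construction (k : ℕ) where

  N : ℕ
  N = k + k + k

  -- Node k + y is adjacent to the clique nodes x > y and node 2k + y to those x ≤ y, so
  -- clique node x has x neighbours in [k, 2k) (painted black) and k − x in [2k, 3k) (white).
  attached : ℕ → ℕ → Bool
  attached x z = if z <ᵇ k + k then z ∸ k <ᵇ x else not (z ∸ (k + k) <ᵇ x)

  edge : ℕ → ℕ → Bool
  edge x y = if x <ᵇ k then (if y <ᵇ k then not (x ≡ᵇ y) else attached x y)
                       else (if y <ᵇ k then attached y x else false)

  edge-sym : ∀ x y → edge x y ≡ edge y x
  edge-sym x y with x <ᵇ k | y <ᵇ k
  ... | true  | true  = cong not (≡ᵇ-sym x y)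
  ... | true  | false = refl
  ... | false | true  = refl
  ... | false | false = refl

  edge-irrefl : ∀ x → edge x x ≡ false
  edge-irrefl x with x <ᵇ k
  ... | true  = cong not (≡ᵇ-refl x)
  ... | false = refl

  open PrefixGraph N edge public

  G : Graph N
  G = graph edge-sym edge-irrefl

  paint : (ℕ → Color) → ℕ → Color
  paint c y = if y <ᵇ k then c y else y <ᵇ k + k

  paint-cong : ∀ {c c′ : ℕ → Color} → c ≗ c′ → paint c ≗ paint c′
  paint-cong c≗c′ y = cong (λ b → if y <ᵇ k then b else y <ᵇ k + k) (c≗c′ y)

  paint-clique : ∀ c {x} → x < k → paint c x ≡ c x
  paint-clique c x<k rewrite <ᵇ-true x<k = refl

  switch-paint : ∀ c {x} → x < k → switchℕ (paint c) x ≗ paint (switchℕ c x)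
  switch-paint c {x} x<k y with y ≟ x
  ... | yes refl rewrite ≡ᵇ-refl y | <ᵇ-true x<k = refl
  ... | no  y≢x  rewrite ≡ᵇ-false y≢x = refl

  module _ (c : ℕ → Color) {x : ℕ} (x<k : x < k) where

    private
      nbr : Color → ℕ → Bool
      nbr b y = edge x y ∧ sameColor (paint c y) b

      in-clique : ∀ b y → y < k → nbr b y ≡ not (x ≡ᵇ y) ∧ sameColor (c y) b
      in-clique b y y<k rewrite <ᵇ-true x<k | <ᵇ-true y<k = refl

      in-middle : ∀ b y → y < k → nbr b (k + y) ≡ (y <ᵇ x) ∧ sameColor true b
      in-middle b y y<k rewrite <ᵇ-true x<k | <ᵇ-false (m≤m+n k y) | <ᵇ-true (+-monoʳ-< k y<k) | m+n∸m≡n k y = refl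

      in-last : ∀ b y → nbr b (k + k + y) ≡ not (y <ᵇ x) ∧ sameColor false b
      in-last b y rewrite <ᵇ-true x<k | <ᵇ-false (≤-trans (m≤m+n k k) (m≤m+n (k + k) y))
                        | <ᵇ-false (m≤m+n (k + k) y) | m+n∸m≡n (k + k) y = refl

    blacks whites : ℕ
    blacks = nbrCountℕ (paint c) x true
    whites = nbrCountℕ (paint c) x false

    nbrCount-paint : ∀ b → nbrCountℕ (paint c) x b ≡
      count k (λ y → not (x ≡ᵇ y) ∧ sameColor (c y) b) + count k (λ y → (y <ᵇ x) ∧ sameColor true b)
        + count k (λ y → not (y <ᵇ x) ∧ sameColor false b)
    nbrCount-paint b =
      trans (count-+ (k + k) k (nbr b))
        (cong₂ _+_ (trans (count-+ k k (nbr b)) (cong₂ _+_ (count-cong k (in-clique b)) (count-cong k (in-middle b))))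
                   (count-cong k (λ y _ → in-last b y)))

    black-nbrs : blacks + χ (c x) ≡ count k c + x
    black-nbrs = begin
      blacks + χ (c x)
        ≡⟨ cong (_+ χ (c x)) (nbrCount-paint true) ⟩
      count k (λ y → not (x ≡ᵇ y) ∧ sameColor (c y) true) + count k (λ y → (y <ᵇ x) ∧ true)
        + count k (λ y → not (y <ᵇ x) ∧ false) + χ (c x)
        ≡⟨ cong (_+ χ (c x)) (cong₂ _+_ (cong₂ _+_ clique middle-block) last-block) ⟩
      other-blacks + x + 0 + χ (c x)
        ≡⟨ rearrange other-blacks x (χ (c x)) ⟩
      other-blacks + χ (c x) + x
        ≡⟨ cong (_+ x) (count-drop k c x<k) ⟩
      count k c + x
        ∎
      where
      open ≡-Reasoning
      other-blacks : ℕ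
      other-blacks = count k (λ y → not (x ≡ᵇ y) ∧ c y)
      clique : count k (λ y → not (x ≡ᵇ y) ∧ sameColor (c y) true) ≡ other-blacks
      clique = count-cong k (λ y _ → cong (not (x ≡ᵇ y) ∧_) (sameColor-true (c y)))
      middle-block : count k (λ y → (y <ᵇ x) ∧ true) ≡ x
      middle-block = trans (count-cong k (λ y _ → ∧-identityʳ (y <ᵇ x))) (count-< (<⇒≤ x<k))
      last-block : count k (λ y → not (y <ᵇ x) ∧ false) ≡ 0
      last-block = count-false k (λ y _ → ∧-zeroʳ (not (y <ᵇ x)))
      rearrange : ∀ a x e → a + x + 0 + e ≡ a + e + x
      rearrange = solve-∀

    white-nbrs : whites + χ (not (c x)) + (count k c + x) ≡ k + k
    white-nbrs = begin
      whites + χ (not (c x)) + (count k c + x)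
        ≡⟨ cong (λ n → n + χ (not (c x)) + (count k c + x)) (nbrCount-paint false) ⟩
      count k (λ y → not (x ≡ᵇ y) ∧ sameColor (c y) false) + count k (λ y → (y <ᵇ x) ∧ false)
        + count k (λ y → not (y <ᵇ x) ∧ true) + χ (not (c x)) + (count k c + x)
        ≡⟨ cong (λ n → n + χ (not (c x)) + (count k c + x)) (cong₂ _+_ (cong₂ _+_ clique middle-block) last-block) ⟩
      other-whites + 0 + whites-beyond + χ (not (c x)) + (count k c + x)
        ≡⟨ rearrange other-whites whites-beyond (χ (not (c x))) (count k c) x ⟩
      count k c + (other-whites + χ (not (c x))) + (x + whites-beyond)
        ≡⟨ cong₂ _+_ (trans (cong (count k c +_) (count-drop k (not ∘ c) x<k)) (count-not k c)) beyond-x ⟩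
      k + k
        ∎
      where
      open ≡-Reasoning
      other-whites whites-beyond : ℕ
      other-whites = count k (λ y → not (x ≡ᵇ y) ∧ not (c y))
      whites-beyond = count k (λ y → not (y <ᵇ x))
      clique : count k (λ y → not (x ≡ᵇ y) ∧ sameColor (c y) false) ≡ other-whites
      clique = count-cong k (λ y _ → cong (not (x ≡ᵇ y) ∧_) (sameColor-false (c y)))
      middle-block : count k (λ y → (y <ᵇ x) ∧ false) ≡ 0
      middle-block = count-false k (λ y _ → ∧-zeroʳ (y <ᵇ x))
      last-block : count k (λ y → not (y <ᵇ x) ∧ true) ≡ whites-beyond
      last-block = count-cong k (λ y _ → ∧-identityʳ (not (y <ᵇ x)))
      beyond-x : x + whites-beyond ≡ k
      beyond-x = trans (cong (_+ whites-beyond) (sym (count-< (<⇒≤ x<k)))) (count-not k (_<ᵇ x))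
      rearrange : ∀ a d e b x → a + 0 + d + e + (b + x) ≡ b + (a + e) + (x + d)
      rearrange = solve-∀

    switchable-white : c x ≡ false → count k c + x < k → Switchableℕ (paint c) x
    switchable-white cx≡false B+x<k =
      switchable-at false (trans (paint-clique c x<k) cx≡false) (subst (_< whites) (sym black) (below-half white B+x<k))
      where
      black : blacks ≡ count k c + x
      black = trans (sym (+-identityʳ blacks)) (subst (λ b → blacks + χ b ≡ count k c + x) cx≡false black-nbrs)
      white : whites + 1 + (count k c + x) ≡ k + k
      white = subst (λ b → whites + χ (not b) + (count k c + x) ≡ k + k) cx≡false white-nbrs

    switchable-black : c x ≡ true → k < count k c + x → Switchableℕ (paint c) x
    switchable-black cx≡true k<B+x =
      switchable-at true (trans (paint-clique c x<k) cx≡true) (<-≤-trans (above-half white k<B+x) k≤blacks)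
      where
      black : blacks + 1 ≡ count k c + x
      black = subst (λ b → blacks + χ b ≡ count k c + x) cx≡true black-nbrs
      white : whites + (count k c + x) ≡ k + k
      white = trans (cong (_+ (count k c + x)) (sym (+-identityʳ whites)))
                    (subst (λ b → whites + χ (not b) + (count k c + x) ≡ k + k) cx≡true white-nbrs)
      k≤blacks : k ≤ blacks
      k≤blacks = m<1+n⇒m≤n (subst (k <_) (trans (sym black) (+-comm blacks 1)) k<B+x)

  k≤N : k ≤ N
  k≤N = ≤-trans (m≤m+n k k) (m≤m+n (k + k) k)

  step : ∀ {c c′} x ys → x < k → Switchableℕ (paint c) x → switchℕ c x ≗ c′ →
         ValidSeqℕ (paint c′) ys → ValidSeqℕ (paint c) (x ∷ ys)
  step {c} x ys x<k switchable switched valid =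
    <-≤-trans x<k k≤N , switchable ,
    ValidSeqℕ-cong ys (λ y → sym (trans (switch-paint c x<k y) (paint-cong switched y))) valid

  descend : ∀ d {p r} ys → p + d ≤ r → r ≤ k → p + r ≤ k →
            ValidSeqℕ (paint (band p p r)) ys → ValidSeqℕ (paint (band p (p + d) r)) (applyDownFrom (p +_) d ++ ys)
  descend zero {p} {r} ys _ _ _ valid = subst (λ q → ValidSeqℕ (paint (band p q r)) ys) (sym (+-identityʳ p)) valid
  descend (suc d) {p} {r} ys p+d<r r≤k p+r≤k valid =
    subst (λ q → ValidSeqℕ (paint (band p q r)) (applyDownFrom (p +_) (suc d) ++ ys)) (sym (+-suc p d))
      (step {c} {band p j r} j _ j<k
        (switchable-white c j<k (band-below {p} {j} {r} p≤j) B+j<k) (switch-band-grow p≤j j<r)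
        (descend d {p} {r} ys (<⇒≤ j<r) r≤k p+r≤k valid))
    where
    j = p + d
    c = band p (suc j) r
    p≤j : p ≤ j
    p≤j = m≤m+n p d
    j<r : j < r
    j<r = subst (_≤ r) (+-suc p d) p+d<r
    j<k : j < k
    j<k = <-≤-trans j<r r≤k
    B+j<k : count k c + j < k
    B+j<k = ≤-trans (≤-reflexive (trans (sym (+-suc (count k c) j)) (count-band (m≤n⇒m≤1+n p≤j) j<r r≤k))) p+r≤k

  ascend : ∀ d {p q r} ys → p ≤ q → q + d ≤ r → r ≤ k → k < p + r →
           ValidSeqℕ (paint (band p (q + d) r)) ys → ValidSeqℕ (paint (band p q r)) (ascending q d ++ ys)
  ascend zero {p} {q} {r} ys _ _ _ _ valid = subst (λ q′ → ValidSeqℕ (paint (band p q′ r)) ys) (+-identityʳ q) valid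
  ascend (suc d) {p} {q} {r} ys p≤q q+d<r r≤k k<p+r valid =
    step {c} {band p (suc q) r} q _ q<k
      (switchable-black c q<k (band-at p≤q q<r) k<B+q) (switch-band-shrink p≤q q<r)
      (ascend d {p} {suc q} {r} ys (m≤n⇒m≤1+n p≤q) (subst (_≤ r) (+-suc q d) q+d<r) r≤k k<p+r
        (subst (λ q′ → ValidSeqℕ (paint (band p q′ r)) ys) (+-suc q d) valid))
    where
    c = band p q r
    q<r : q < r
    q<r = <-≤-trans (s≤s (m≤m+n q d)) (subst (_≤ r) (+-suc q d) q+d<r)
    q<k : q < k
    q<k = <-≤-trans q<r r≤k
    k<B+q : k < count k c + q
    k<B+q = subst (k <_) (sym (count-band p≤q (<⇒≤ q<r) r≤k)) k<p+r

  schedule-valid : ∀ i a → a + (a + (i + i)) ≡ k → ValidSeqℕ (paint (_<ᵇ a)) (schedule a i)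
  schedule-valid zero    a _    = tt
  schedule-valid (suc i) a a+r≡k =
    ValidSeqℕ-cong _ (paint-cong (band-prefix {a} {r} {r} ≤-refl))
      (descend (suc i + suc i) {a} {r} _ ≤-refl r≤k (≤-reflexive a+r≡k)
        (ValidSeqℕ-cong _ (paint-cong filled)
          (ascend (i + suc i) {suc a} {suc a} {r} _ ≤-refl (≤-reflexive r≡) r≤k (s≤s (≤-reflexive (sym a+r≡k)))
            (ValidSeqℕ-cong _ (paint-cong (λ y → sym (band-prefix {suc a} (≤-reflexive (sym r≡)) y)))
              (schedule-valid i (suc a) (trans (rearrange a i) a+r≡k))))))
    where
    r = a + (suc i + suc i)
    r≤k : r ≤ k
    r≤k = subst (r ≤_) a+r≡k (m≤n+m r a)
    r≡ : suc a + (i + suc i) ≡ r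
    r≡ = sym (+-suc a (i + suc i))
    filled : band (suc a) (suc a) r ≗ band a a r
    filled y = trans (band-filled ≤-refl (≤-trans (m≤m+n (suc a) (i + suc i)) (≤-reflexive r≡)) y)
                     (sym (band-filled ≤-refl (m≤m+n a (suc i + suc i)) y))
    rearrange : ∀ a i → suc a + (suc a + (i + i)) ≡ a + (a + (suc i + suc i))
    rearrange = solve-∀

quadratic-bound : ∀ m → (m + m + (m + m) + (m + m)) * (m + m + (m + m) + (m + m)) ≤ 18 * (m * (m + m) + m)
quadratic-bound m = begin
  (m + m + (m + m) + (m + m)) * (m + m + (m + m) + (m + m)) ≡⟨ square m ⟩
  18 * (m * (m + m))                                          ≤⟨ *-monoʳ-≤ 18 (m≤m+n (m * (m + m)) m) ⟩
  18 * (m * (m + m) + m)                                      ∎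
  where
  open ≤-Reasoning
  square : ∀ m → (m + m + (m + m) + (m + m)) * (m + m + (m + m) + (m + m)) ≡ 18 * (m * (m + m))
  square = solve-∀

theorem1 : Σ ℕ λ d → 1 ≤ d × ((m : ℕ) → Σ ℕ λ n → m ≤ n × Σ (Graph n) λ G → Σ (Coloring n) λ col → Σ (List _) λ σ → ValidSeq G col σ × n * n ≤ d * length σ)
theorem1 = 18 , s≤s z≤n , λ m →
  let open Construction (m + m)
      σ , valid , len = toValidSeq edge-sym edge-irrefl (schedule 0 m) (λ _ → refl) (schedule-valid m 0 refl)
  in  N , ≤-trans (m≤m+n m m) k≤N , G , paint (_<ᵇ 0) ∘ toℕ , σ , valid ,
      subst (λ l → N * N ≤ 18 * l) (sym (trans len (length-schedule m 0))) (quadratic-bound m)
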